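{- Let $N=(V,E,\tau)$ and $M=(V',E',\tau')$ be temporal networks whose underlying graphs are isomorphic but which are not label isomorphic. Suppose there is a finite sequence of transpositions of temporal labels $p_1,\ldots,p_n$, where each $p_i$, at the moment it is applied, swaps two consecutive labels $s$ and $s+1$ that lie on two non-adjacent edges, such that the labeling $\pi(N)$ obtained from $N$ by successively applying these transpositions (i.e. $\pi=p_1p_2\cdots p_n$) is label isomorphic to $M$. Then $N$ and $M$ are temporally isomorphic.
   Context: A temporal network $N=(V,E,\tau)$ is a finite graph $(V,E)$ together with a bijection $\tau:E\to\{1,2,\ldots,|E|\}$. Two edges are adjacent if they share a vertex. A temporal path is a sequence of edges $\langle\{v_1,v_2\},\{v_2,v_3\},\ldots,\{v_k,v_{k+1}\}\rangle$ whose labels are strictly increasing along the sequence. $N$ and $M$ are temporally isomorphic if there is a graph isomorphism $\phi:V\to V'$ mapping every temporal path $\langle\{v_1,v_2\},\ldots,\{v_k,v_{k+1}\}\rangle$ of $N$ to a temporal path $\langle\{\phi(v_1),\phi(v_2)\},\ldots,\{\phi(v_k),\phi(v_{k+1})\}\rangle$ of $M$. $N$ and $M$ are label isomorphic if there is a graph isomorphism $\phi$ with $\tau(\{v_i,v_j\})=\tau'(\{\phi(v_i),\phi(v_j)\})$ for every edge $\{v_i,v_j\}\in E$. -}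

module Defs where

open import Data.Nat using (ℕ; suc; _<_)
open import Data.Fin using (Fin; toℕ)
open import Data.Fin.Permutation using (Permutation; Permutation′; _⟨$⟩ʳ_; transpose)
open import Data.Product using (_×_; _,_; ∃; ∃-syntax; proj₁; proj₂)
open import Data.Sum using (_⊎_)
open import Data.List using (List; []; _∷_; map)
open import Relation.Binary.PropositionalEquality using (_≡_; _≢_)
open import Relation.Binary.Construct.Closure.ReflexiveTransitive using (Star)
open import Relation.Nullary using (¬_)
open import Function.Bundles using (_⇔_)

record Graph : Set where
  field
    n : ℕ
    m : ℕ
    edge : Fin m → Fin n × Fin n
    loopless : ∀ i → proj₁ (edge i) ≢ proj₂ (edge i)

  Joins : Fin m → Fin n → Fin n → Set
  Joins i u v = (edge i ≡ (u , v)) ⊎ (edge i ≡ (v , u))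

  field
    simple : ∀ i j u v → Joins i u v → Joins j u v → i ≡ j

  Adj : Fin n → Fin n → Set
  Adj u v = ∃[ i ] Joins i u v

  Incident : Fin m → Fin n → Set
  Incident i w = (proj₁ (edge i) ≡ w) ⊎ (proj₂ (edge i) ≡ w)

  AdjacentEdges : Fin m → Fin m → Set
  AdjacentEdges i j = ∃[ w ] (Incident i w × Incident j w)

open Graph

-- A temporal network: a graph together with a bijection τ from edges onto
-- the labels; labels {1,…,|E|} are represented 0-based as Fin m.
record TNet : Set where
  constructor tnet
  field
    graph : Graph
    τ : Permutation′ (m graph)

open TNet

lab : (N : TNet) → Fin (m (graph N)) → ℕ
lab N i = toℕ (τ N ⟨$⟩ʳ i)

-- TP N e vs : vs = v₁ ∷ v₂ ∷ … ∷ v_{k+1} is the vertex sequence of a temporal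
-- path ⟨{v₁,v₂},…,{v_k,v_{k+1}}⟩ of N whose first edge is e.
data TP (N : TNet) : Fin (m (graph N)) → List (Fin (n (graph N))) → Set where
  one  : ∀ {e u v} → Joins (graph N) e u v → TP N e (u ∷ v ∷ [])
  more : ∀ {e e′ u v vs} → Joins (graph N) e u v → lab N e < lab N e′ →
         TP N e′ (v ∷ vs) → TP N e (u ∷ v ∷ vs)

TemporalPath : (N : TNet) → List (Fin (n (graph N))) → Set
TemporalPath N vs = ∃[ e ] TP N e vs

IsGraphIso : (G H : Graph) → Permutation (n G) (n H) → Set
IsGraphIso G H φ = ∀ u v → Adj G u v ⇔ Adj H (φ ⟨$⟩ʳ u) (φ ⟨$⟩ʳ v)

GraphIsomorphic : Graph → Graph → Set
GraphIsomorphic G H = ∃[ φ ] IsGraphIso G H φ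

TemporallyIsomorphic : TNet → TNet → Set
TemporallyIsomorphic N M =
  ∃[ φ ] (IsGraphIso (graph N) (graph M) φ ×
    (∀ vs → TemporalPath N vs → TemporalPath M (map (φ ⟨$⟩ʳ_) vs)))

LabelIsomorphic : TNet → TNet → Set
LabelIsomorphic N M =
  ∃[ φ ] (IsGraphIso (graph N) (graph M) φ ×
    (∀ e u v → Joins (graph N) e u v →
      ∃[ e′ ] (Joins (graph M) e′ (φ ⟨$⟩ʳ u) (φ ⟨$⟩ʳ v) × lab M e′ ≡ lab N e)))

Step : (G : Graph) → Permutation′ (m G) → Permutation′ (m G) → Set
Step G τ₁ τ₂ =
  ∃[ s ] ∃[ t ] (toℕ t ≡ suc (toℕ s) ×
    (∀ e₁ e₂ → τ₁ ⟨$⟩ʳ e₁ ≡ s → τ₁ ⟨$⟩ʳ e₂ ≡ t → ¬ AdjacentEdges G e₁ e₂) ×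
    (∀ e → τ₂ ⟨$⟩ʳ e ≡ transpose s t ⟨$⟩ʳ (τ₁ ⟨$⟩ʳ e)))

Transposes : (G : Graph) → Permutation′ (m G) → Permutation′ (m G) → Set
Transposes G = Star (Step G)

-- Swapping two consecutive labels s, s+1 changes the relative order of exactly
-- one pair of edges: the two edges carrying s and s+1.  Consecutive edges of a
-- temporal path are adjacent, so when those two edges are non-adjacent every
-- temporal path survives the swap.  Hence N's temporal paths are temporal paths
-- of π(N), and a label isomorphism π(N) ≅ M maps them to temporal paths of M.
module Submission where

open import Defs
open import Relation.Nullary using (¬_; yes; no)
open import Data.Fin.Permutation using (Permutation′; _⟨$⟩ʳ_)
import Data.Fin.Permutation.Components as PC
open import Data.Fin using (Fin; toℕ; _≟_)
open import Data.Fin.Properties using (toℕ-injective)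
open import Data.Nat using (suc; _<_)
open import Data.Nat.Properties using (<-trans; <-irrefl; ≤∧≢⇒<; n<1+n; m<1+n⇒m≤n)
open import Data.Product using (_×_; _,_; ∃-syntax; proj₁; proj₂)
open import Data.Sum using (inj₁; inj₂)
open import Data.List using (_∷_; map)
open import Data.Empty using (⊥-elim)
open import Relation.Binary.PropositionalEquality
  using (_≡_; _≢_; refl; sym; trans; cong; subst₂)
open import Relation.Binary.Construct.Closure.ReflexiveTransitive using (ε; _◅_)
open Graph

data TransposeView {n} (s t x : Fin n) : Fin n → Set where
  at-s  : x ≡ s → TransposeView s t x t
  at-t  : x ≢ s → x ≡ t → TransposeView s t x s
  fixed : x ≢ s → x ≢ t → TransposeView s t x x

transposeView : ∀ {n} (s t x : Fin n) → TransposeView s t x (PC.transpose s t x)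
transposeView s t x with x ≟ s
... | yes x≡s = at-s x≡s
... | no x≢s with x ≟ t
...   | yes x≡t = at-t x≢s x≡t
...   | no x≢t = fixed x≢s x≢t

transpose-consecutive-preserves-< : ∀ {n} (s t a b : Fin n) →
  toℕ t ≡ suc (toℕ s) → toℕ a < toℕ b → ¬ (a ≡ s × b ≡ t) →
  toℕ (PC.transpose s t a) < toℕ (PC.transpose s t b)
transpose-consecutive-preserves-< s t a b t≡1+s a<b ¬[s,t] =
  order (transposeView s t a) (transposeView s t b)
  where
  order : ∀ {x y} → TransposeView s t a x → TransposeView s t b y → toℕ x < toℕ y
  order (at-s refl)   (at-s refl)   = ⊥-elim (<-irrefl refl a<b)
  order (at-s refl)   (at-t _ b≡t)  = ⊥-elim (¬[s,t] (refl , b≡t))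
  order (at-s refl)   (fixed _ b≢t) rewrite t≡1+s =
    ≤∧≢⇒< a<b (λ 1+s≡b → b≢t (toℕ-injective (trans (sym 1+s≡b) (sym t≡1+s))))
  order (at-t _ refl) (at-s refl)   rewrite t≡1+s =
    ⊥-elim (<-irrefl refl (<-trans a<b (n<1+n _)))
  order (at-t _ refl) (at-t _ refl) = ⊥-elim (<-irrefl refl a<b)
  order (at-t _ refl) (fixed _ _)   rewrite t≡1+s = <-trans (n<1+n _) a<b
  order (fixed _ _)   (at-s refl)   rewrite t≡1+s = <-trans a<b (n<1+n _)
  order (fixed a≢s _) (at-t _ refl) rewrite t≡1+s =
    ≤∧≢⇒< (m<1+n⇒m≤n a<b) (λ a≡s → a≢s (toℕ-injective a≡s))
  order (fixed _ _)   (fixed _ _)   = a<b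

module _ (G : Graph) where

  Joins⇒Incident₁ : ∀ {i u v} → Joins G i u v → Incident G i u
  Joins⇒Incident₁ (inj₁ eq) = inj₁ (cong proj₁ eq)
  Joins⇒Incident₁ (inj₂ eq) = inj₂ (cong proj₂ eq)

  Joins⇒Incident₂ : ∀ {i u v} → Joins G i u v → Incident G i v
  Joins⇒Incident₂ (inj₁ eq) = inj₂ (cong proj₂ eq)
  Joins⇒Incident₂ (inj₂ eq) = inj₁ (cong proj₁ eq)

  TP-head-incident : ∀ {τ e v vs} → TP (tnet G τ) e (v ∷ vs) → Incident G e v
  TP-head-incident (one j)      = Joins⇒Incident₁ j
  TP-head-incident (more j _ _) = Joins⇒Incident₁ j

  PreservesAdjacentOrder : Permutation′ (m G) → Permutation′ (m G) → Set
  PreservesAdjacentOrder τ₁ τ₂ = ∀ e e′ → AdjacentEdges G e e′ →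
    lab (tnet G τ₁) e < lab (tnet G τ₁) e′ → lab (tnet G τ₂) e < lab (tnet G τ₂) e′

  PreservesAdjacentOrder⇒TP : ∀ {τ₁ τ₂} → PreservesAdjacentOrder τ₁ τ₂ →
    ∀ {e vs} → TP (tnet G τ₁) e vs → TP (tnet G τ₂) e vs
  PreservesAdjacentOrder⇒TP mono (one j) = one j
  PreservesAdjacentOrder⇒TP mono (more {v = v} j lt p) =
    more j (mono _ _ (v , Joins⇒Incident₂ j , TP-head-incident p) lt)
      (PreservesAdjacentOrder⇒TP mono p)

  Step⇒PreservesAdjacentOrder : ∀ {τ₁ τ₂} → Step G τ₁ τ₂ → PreservesAdjacentOrder τ₁ τ₂
  Step⇒PreservesAdjacentOrder (s , t , t≡1+s , nonadjacent , τ₂≗swap∘τ₁) e e′ adj lt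
    rewrite τ₂≗swap∘τ₁ e | τ₂≗swap∘τ₁ e′ =
    transpose-consecutive-preserves-< s t _ _ t≡1+s lt
      (λ (τ₁e≡s , τ₁e′≡t) → nonadjacent e e′ τ₁e≡s τ₁e′≡t adj)

  Transposes⇒TemporalPath : ∀ {τ₁ τ₂} → Transposes G τ₁ τ₂ →
    ∀ {vs} → TemporalPath (tnet G τ₁) vs → TemporalPath (tnet G τ₂) vs
  Transposes⇒TemporalPath ε p = p
  Transposes⇒TemporalPath {τ₁} (_◅_ {j = τ} step steps) (e , p) =
    Transposes⇒TemporalPath steps
      (e , PreservesAdjacentOrder⇒TP (Step⇒PreservesAdjacentOrder {τ₁} {τ} step) p)

LabelIsomorphic⇒TP : (N M : TNet) (iso : LabelIsomorphic N M) → ∀ {e vs} → TP N e vs →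
  ∃[ e′ ] (TP M e′ (map (proj₁ iso ⟨$⟩ʳ_) vs) × lab M e′ ≡ lab N e)
LabelIsomorphic⇒TP N M (φ , _ , labels) (one j) with labels _ _ _ j
... | e′ , j′ , same = e′ , one j′ , same
LabelIsomorphic⇒TP N M iso@(φ , _ , labels) (more j lt p)
  with labels _ _ _ j | LabelIsomorphic⇒TP N M iso p
... | e′ , j′ , same | e″ , p′ , same′ =
  e′ , more j′ (subst₂ _<_ (sym same) (sym same′) lt) p′ , same

LabelIsomorphic⇒TemporalPath : (N M : TNet) (iso : LabelIsomorphic N M) →
  ∀ {vs} → TemporalPath N vs → TemporalPath M (map (proj₁ iso ⟨$⟩ʳ_) vs)
LabelIsomorphic⇒TemporalPath N M iso (e , p) =
  let (e′ , p′ , _) = LabelIsomorphic⇒TP N M iso p in e′ , p′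

proposition2 : (N M : TNet) →
    GraphIsomorphic (TNet.graph N) (TNet.graph M) →
    ¬ LabelIsomorphic N M →
    (π : Permutation′ (Graph.m (TNet.graph N))) → Transposes (TNet.graph N) (TNet.τ N) π →
    LabelIsomorphic (tnet (TNet.graph N) π) M →
    TemporallyIsomorphic N M
proposition2 N M _ _ π transposes iso@(φ , φ-graph-iso , _) =
  φ , φ-graph-iso , λ vs p →
    LabelIsomorphic⇒TemporalPath (tnet (TNet.graph N) π) M iso
      (Transposes⇒TemporalPath (TNet.graph N) transposes p)
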